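{- Let $\mathcal Z$ be a finite zero-set with growth transformation $\mathcal T$. There exists a time $T_{\max}=T_{\max}(\mathcal Z)$ such that for every set $A\subseteq\mathbb Z_+^2$, finite or infinite, $$\mathcal T^{T_{\max}+1}(A)=\mathcal T^{T_{\max}}(A).$$
   Context: $\mathbb Z_+=\{0,1,2,\dots\}$; $R_{a,b}=([0,a-1]\times[0,b-1])\cap\mathbb Z_+^2$. A zero-set is a union of sets $R_{a,b}$. For $A\subseteq\mathbb Z_+^2$, $\mathrm{row}(x,A)$, $\mathrm{col}(x,A)$ are the numbers of points of $A$ on the horizontal/vertical line through $x$ (possibly infinite; an infinite count is never in a finite $\mathcal Z$). The growth transformation is $\mathcal T(A)=A\cup\{x\notin A:(\mathrm{row}(x,A),\mathrm{col}(x,A))\notin\mathcal Z\}$. -}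

module Defs where

open import Level using (0ℓ)
open import Data.Nat using (ℕ; zero; suc; _<_)
open import Data.Product using (_×_; _,_; Σ-syntax; ∃-syntax)
open import Data.Sum using (_⊎_)
open import Data.List using (List; length)
open import Data.List.Relation.Unary.Any using (Any)
open import Data.List.Relation.Unary.Unique.Propositional using (Unique)
open import Data.List.Membership.Propositional using (_∈_)
open import Relation.Nullary using (¬_)
open import Relation.Binary.PropositionalEquality using (_≡_)
open import Function.Bundles using (_⇔_)

Subset² : Set₁
Subset² = ℕ → ℕ → Set

-- A subset P of ℤ₊ has (finite) cardinality n: it is exactly the set of
-- entries of a duplicate-free list of length n.  A set with no finite
-- cardinality has infinite cardinality.
HasCount : (ℕ → Set) → ℕ → Set
HasCount P n = Σ[ xs ∈ List ℕ ] (Unique xs × length xs ≡ n × (∀ y → (P y ⇔ y ∈ xs)))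

-- A finite zero-set is given as a finite union of rectangles R_{a,b}
-- (list of the pairs (a , b)).  (m , n) ∈ ⋃ R_{a,b}  iff  m < a and n < b for some (a,b).
ZeroSet : Set
ZeroSet = List (ℕ × ℕ)

_∈Z_ : ℕ × ℕ → ZeroSet → Set
(m , n) ∈Z Z = Any (λ { (a , b) → m < a × n < b }) Z

rowSet : Subset² → ℕ → ℕ → (ℕ → Set)
rowSet A i j y = A y j

colSet : Subset² → ℕ → ℕ → (ℕ → Set)
colSet A i j y = A i y

-- (row(x,A), col(x,A)) ∈ Z ; an infinite count is never in the finite Z,
-- so membership requires both counts to be finite.
CountsInZ : ZeroSet → Subset² → ℕ → ℕ → Set
CountsInZ Z A i j =
  ∃[ m ] ∃[ n ] (HasCount (rowSet A i j) m × HasCount (colSet A i j) n × (m , n) ∈Z Z)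

𝒯 : ZeroSet → Subset² → Subset²
𝒯 Z A i j = A i j ⊎ (¬ A i j × ¬ CountsInZ Z A i j)

𝒯^ : ZeroSet → ℕ → Subset² → Subset²
𝒯^ Z zero    A = A
𝒯^ Z (suc k) A = 𝒯 Z (𝒯^ Z k A)

_≐_ : Subset² → Subset² → Set
A ≐ B = ∀ i j → (A i j ⇔ B i j)

module Submission where

-- Write Z ⊆ [0,M) × [0,N+1) and let a be least with (a , N) ∉ Z; we induct on M + N.
-- Within the first T steps either no column ever holds more than N points, or some
-- column does. In the first case a row with fewer than a points is blocked everywhere
-- (since (r , N) ∈ Z for r < a), so it never changes, and on the remaining rows the
-- zone behaves like {(m , n) | (m ⊔ a , n) ∈ Z}, which misses height N. In the second
-- case the column has no blocked point, so one step later it is full; deleting it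
-- lowers every row count by one, giving the zone {(m , n) | (1 + m , n) ∈ Z}. Both
-- reductions need growth restricted to a set of rows and a set of columns, so the
-- induction runs over that generalisation, with stabilisation time T(s+1) = 2 T(s) + 1.
-- Excluded middle decides the case split and turns "at most m points" into a count.

open import Defs
open import Level using (0ℓ)
open import Axiom.ExcludedMiddle using (ExcludedMiddle)
open import Data.Nat using (ℕ; zero; suc; _+_; _≤_; _<_; _⊔_; z≤n; s≤s; _≟_; _∸_; _≤?_)
open import Data.Nat.Properties
open import Data.Product using (_×_; _,_; proj₁; proj₂; ∃; ∃-syntax)
open import Data.Sum using (_⊎_; inj₁; inj₂; [_,_]′)
open import Data.Unit using (tt)
open import Data.Empty using (⊥-elim)
open import Data.List using ([]; _∷_; length; map)
open import Data.Nat.ListAction using (sum)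
open import Data.List.Relation.Unary.All as All using (All; []; _∷_)
open import Data.List.Relation.Unary.All.Properties using (anti-mono)
open import Data.List.Relation.Unary.Any using (here; there)
open import Data.List.Relation.Unary.AllPairs using ([]; _∷_)
open import Data.List.Relation.Unary.Unique.Propositional using (Unique)
open import Data.List.Membership.Propositional using (_∈_)
open import Data.List.Relation.Binary.Subset.Propositional using () renaming (_⊆_ to _⊆ˡ_)
open import Data.List.Relation.Binary.Subset.Propositional.Properties using (∷⁺ʳ)
open import Relation.Nullary using (¬_; Dec; yes; no)
open import Relation.Unary using (Pred; Decidable; _⊆_; _∩_; _∖_; ｛_｝; U)
open import Relation.Binary.PropositionalEquality using (_≡_; _≢_; refl; sym; cong; subst)
open import Function.Base using (_∘_; id)
open import Function.Bundles using (_⇔_; mk⇔; Equivalence)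

private variable
  P Q : Pred ℕ 0ℓ
  k m n : ℕ

AtLeast : Pred ℕ 0ℓ → ℕ → Set
AtLeast P k = ∃[ xs ] (Unique xs × k ≤ length xs × All P xs)

AtMost : Pred ℕ 0ℓ → ℕ → Set
AtMost P m = ¬ AtLeast P (suc m)

atLeast-mono : P ⊆ Q → AtLeast P k → AtLeast Q k
atLeast-mono P⊆Q (xs , u , k≤ , ps) = xs , u , k≤ , All.map P⊆Q ps

atMost-anti : P ⊆ Q → AtMost Q m → AtMost P m
atMost-anti P⊆Q ≤m = ≤m ∘ atLeast-mono P⊆Q

atLeast-weaken : k ≤ n → AtLeast P n → AtLeast P k
atLeast-weaken k≤n (xs , u , n≤ , ps) = xs , u , ≤-trans k≤n n≤ , ps

atLeast-zero : AtLeast P 0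
atLeast-zero = [] , [] , z≤n , []

atLeast-insert : ∀ {z} → P z → AtLeast (P ∖ ｛ z ｝) k → AtLeast P (suc k)
atLeast-insert pz (xs , u , k≤ , ps) =
  _ ∷ xs , All.map proj₂ ps ∷ u , s≤s k≤ , pz ∷ All.map proj₁ ps

unique-delete : ∀ z xs → Unique xs →
                ∃[ ys ] (Unique ys × ys ⊆ˡ xs × All (z ≢_) ys × length xs ≤ suc (length ys))
unique-delete z [] [] = [] , [] , (λ ()) , [] , z≤n
unique-delete z (x ∷ xs) (x∉xs ∷ u) with z ≟ x
... | yes refl = xs , u , there , x∉xs , ≤-refl
... | no z≢x with unique-delete z xs u
...   | ys , u′ , ys⊆xs , z∉ys , len =
  x ∷ ys , anti-mono ys⊆xs x∉xs ∷ u′ , ∷⁺ʳ x ys⊆xs , z≢x ∷ z∉ys , s≤s len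

atLeast-delete : ∀ z → AtLeast P (suc k) → AtLeast (P ∖ ｛ z ｝) k
atLeast-delete z (xs , u , k<len , ps) with unique-delete z xs u
... | ys , u′ , ys⊆xs , z∉ys , len =
  ys , u′ , ≤-pred (≤-trans k<len len) , All.zip (anti-mono ys⊆xs ps , z∉ys)

atMost-∖⇒suc : ∀ z → AtMost (P ∖ ｛ z ｝) m → AtMost P (suc m)
atMost-∖⇒suc z ≤m = ≤m ∘ atLeast-delete z

atMost-suc⇒∖ : ∀ {z} → P z → AtMost P (suc m) → AtMost (P ∖ ｛ z ｝) m
atMost-suc⇒∖ pz ≤1+m = ≤1+m ∘ atLeast-insert pz

atLeast⇒≤length : ∀ ys → P ⊆ (_∈ ys) → AtLeast P k → k ≤ length ys
atLeast⇒≤length {k = zero} ys P⊆ys _ = z≤n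
atLeast⇒≤length {k = suc k} [] P⊆ys (x ∷ _ , _ , _ , px ∷ _) with P⊆ys px
... | ()
atLeast⇒≤length {P} {k = suc k} (y ∷ ys) P⊆y∷ys P≥ =
  s≤s (atLeast⇒≤length ys P∖y⊆ys (atLeast-delete y P≥))
  where
  P∖y⊆ys : P ∖ ｛ y ｝ ⊆ (_∈ ys)
  P∖y⊆ys (px , y≢x) with P⊆y∷ys px
  ... | here x≡y = ⊥-elim (y≢x (sym x≡y))
  ... | there x∈ys = x∈ys

hasCount⇒atMost : HasCount P m → AtMost P m
hasCount⇒atMost (xs , _ , refl , P⇔xs) P≥ =
  1+n≰n (atLeast⇒≤length xs (Equivalence.to (P⇔xs _)) P≥)

hasCount-empty : (∀ x → ¬ P x) → HasCount P 0
hasCount-empty ∅ = [] , [] , refl , λ x → mk⇔ (⊥-elim ∘ ∅ x) (λ ())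

hasCount-insert : ∀ {z} → P z → HasCount (P ∖ ｛ z ｝) k → HasCount P (suc k)
hasCount-insert {P} {z = z} pz (xs , u , refl , P∖z⇔xs) =
  z ∷ xs , All.tabulate (proj₂ ∘ from) ∷ u , refl , λ y → mk⇔ to′ from′
  where
  from : ∀ {y} → y ∈ xs → (P ∖ ｛ z ｝) y
  from {y} = Equivalence.from (P∖z⇔xs y)
  to′ : ∀ {y} → P y → y ∈ z ∷ xs
  to′ {y} py with z ≟ y
  ... | yes z≡y = here (sym z≡y)
  ... | no z≢y = there (Equivalence.to (P∖z⇔xs y) (py , z≢y))
  from′ : ∀ {y} → y ∈ z ∷ xs → P y
  from′ (here refl) = pz
  from′ (there y∈xs) = proj₁ (from y∈xs)

least-counterexample : Decidable P → ¬ P n → ∃[ a ] ((∀ {r} → r < a → P r) × ¬ P a)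
least-counterexample {P} {n} P? ¬Pn =
  [ (λ below → ⊥-elim (¬Pn (below ≤-refl))) , id ]′ (allBelow-or-least (suc n))
  where
  allBelow-or-least : ∀ n → (∀ {r} → r < n → P r) ⊎ ∃[ a ] ((∀ {r} → r < a → P r) × ¬ P a)
  allBelow-or-least zero = inj₁ λ ()
  allBelow-or-least (suc n) with allBelow-or-least n
  ... | inj₂ least = inj₂ least
  ... | inj₁ below with P? n
  ...   | no ¬Pn = inj₂ (n , below , ¬Pn)
  ...   | yes Pn = inj₁ λ r<1+n → [ below , (λ { refl → Pn }) ]′ (m<1+n⇒m<n∨m≡n r<1+n)

private variable
  A B : Subset²
  x y : ℕ

≐-refl : A ≐ A
≐-refl i j = mk⇔ id id

≐-sym : A ≐ B → B ≐ A
≐-sym A≐B i j = mk⇔ (Equivalence.from (A≐B i j)) (Equivalence.to (A≐B i j))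

≐-trans : ∀ {D} → A ≐ B → B ≐ D → A ≐ D
≐-trans A≐B B≐D i j = mk⇔ (Equivalence.to (B≐D i j) ∘ Equivalence.to (A≐B i j))
                          (Equivalence.from (A≐B i j) ∘ Equivalence.from (B≐D i j))

≐⇒⊆ : A ≐ B → A x y → B x y
≐⇒⊆ {x = x} {y} A≐B = Equivalence.to (A≐B x y)

Zone : Set₁
Zone = ℕ → ℕ → Set

DownClosed : Zone → Set
DownClosed Z = ∀ {m n m′ n′} → m′ ≤ m → n′ ≤ n → Z m n → Z m′ n′

BoundedBy : ℕ → ℕ → Zone → Set
BoundedBy M N Z = ∀ {m n} → Z m n → m < M × n < N

row : Pred ℕ 0ℓ → Subset² → ℕ → Pred ℕ 0ℓ
row C A y = C ∩ λ x → A x y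

record Blocked (Z : Zone) (C : Pred ℕ 0ℓ) (A : Subset²) (x y : ℕ) : Set where
  constructor blocked
  field
    rowBound colBound : ℕ
    inZone : Z rowBound colBound
    row≤ : AtMost (row C A y) rowBound
    col≤ : AtMost (A x) colBound

blocked-resp : ∀ {Z C} → A ≐ B → Blocked Z C A x y → Blocked Z C B x y
blocked-resp A≐B (blocked m n z row≤m col≤n) =
  blocked m n z (atMost-anti (λ (c , b) → c , ≐⇒⊆ (≐-sym A≐B) b) row≤m)
                (atMost-anti (≐⇒⊆ (≐-sym A≐B)) col≤n)

-- Points may only be added in rows R and columns C, and the row count of a point sees
-- only the columns in C; column counts see everything. 𝒯 is the case R = C = U.
module Growth (Z : Zone) (R C : Pred ℕ 0ℓ) where

  grow : Subset² → Subset²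
  grow A x y = A x y ⊎ (R y × C x × ¬ A x y × ¬ Blocked Z C A x y)

  grow^ : ℕ → Subset² → Subset²
  grow^ zero    A = A
  grow^ (suc t) A = grow (grow^ t A)

  grow-resp : A ≐ B → grow A ≐ grow B
  grow-resp A≐B x y = mk⇔ (transport A≐B) (transport (≐-sym A≐B))
    where
    transport : ∀ {A B} → A ≐ B → grow A x y → grow B x y
    transport A≐B (inj₁ a) = inj₁ (≐⇒⊆ A≐B a)
    transport A≐B (inj₂ (r , c , ¬a , ¬blocked)) =
      inj₂ (r , c , ¬a ∘ ≐⇒⊆ (≐-sym A≐B) , ¬blocked ∘ blocked-resp (≐-sym A≐B))

  grow^-inflationary : ∀ t → A x y → grow^ t A x y
  grow^-inflationary zero    a = a
  grow^-inflationary (suc t) a = inj₁ (grow^-inflationary t a)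

  grow^-fixesRow : ∀ t → ¬ R y → grow^ t A x y → A x y
  grow^-fixesRow zero    ¬r a = a
  grow^-fixesRow (suc t) ¬r (inj₁ a) = grow^-fixesRow t ¬r a
  grow^-fixesRow (suc t) ¬r (inj₂ (r , _)) = ⊥-elim (¬r r)

  grow^-+ : ∀ k t A → grow^ (k + t) A ≡ grow^ k (grow^ t A)
  grow^-+ zero    t A = refl
  grow^-+ (suc k) t A = cong grow (grow^-+ k t A)

  StableAt : Subset² → ℕ → Set
  StableAt A t = grow (grow^ t A) ≐ grow^ t A

  stableAt-+ : ∀ k {t} → StableAt A t → StableAt A (k + t)
  stableAt-+ zero    stable = stable
  stableAt-+ (suc k) stable = grow-resp (stableAt-+ k stable)

  stableAt-mono : ∀ {t T} → t ≤ T → StableAt A t → StableAt A T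
  stableAt-mono {A} {t} {T} t≤T stable =
    subst (StableAt A) (m∸n+n≡m t≤T) (stableAt-+ (T ∸ t) stable)

  stableAt-1 : (∀ {m n} → ¬ Z m n) → StableAt A 1
  stableAt-1 {A} ∅ x y = mk⇔ stay inj₁
    where
    stay : grow (grow A) x y → grow A x y
    stay (inj₁ a) = a
    stay (inj₂ (r , c , ¬a , _)) =
      ⊥-elim (¬a (inj₂ (r , c , ¬a ∘ inj₁ , ∅ ∘ Blocked.inZone)))

StabilisesBy : Zone → ℕ → Set₁
StabilisesBy Z T = ∀ R C A → Growth.StableAt Z R C A T

private variable
  Z : Zone
  R C : Pred ℕ 0ℓ
  a M N : ℕ

floorRowCount : ℕ → Zone → Zone
floorRowCount a Z m n = Z (m ⊔ a) n

sucRowCount : Zone → Zone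
sucRowCount Z m n = Z (suc m) n

downClosed-floorRowCount : DownClosed Z → DownClosed (floorRowCount a Z)
downClosed-floorRowCount {a = a} dc m′≤m n′≤n = dc (⊔-monoˡ-≤ a m′≤m) n′≤n

boundedBy-floorRowCount : DownClosed Z → BoundedBy M (suc N) Z → ¬ Z a N →
                          BoundedBy M N (floorRowCount a Z)
boundedBy-floorRowCount {a = a} dc bounded ¬Za {m} z with m<1+n⇒m<n∨m≡n (proj₂ (bounded z))
... | inj₁ n<N = ≤-<-trans (m≤m⊔n m a) (proj₁ (bounded z)) , n<N
... | inj₂ refl = ⊥-elim (¬Za (dc (m≤n⊔m m a) ≤-refl z))

downClosed-sucRowCount : DownClosed Z → DownClosed (sucRowCount Z)
downClosed-sucRowCount dc m′≤m = dc (s≤s m′≤m)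

boundedBy-sucRowCount : BoundedBy (suc M) N Z → BoundedBy M N (sucRowCount Z)
boundedBy-sucRowCount bounded z = ≤-pred (proj₁ (bounded z)) , proj₂ (bounded z)

blocked-floorRowCount⇒blocked : DownClosed Z → Blocked (floorRowCount a Z) C A x y → Blocked Z C A x y
blocked-floorRowCount⇒blocked {a = a} dc (blocked m n z row≤m col≤n) =
  blocked m n (dc (m≤m⊔n m a) ≤-refl z) row≤m col≤n

blocked⇒blocked-floorRowCount : AtLeast (row C A y) a → Blocked Z C A x y →
                                Blocked (floorRowCount a Z) C A x y
blocked⇒blocked-floorRowCount {a = a} {Z = Z} row≥a (blocked m n z row≤m col≤n) with a ≤? m
... | yes a≤m = blocked m n (subst (λ v → Z v n) (sym (m≥n⇒m⊔n≡m a≤m)) z) row≤m col≤n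
... | no a≰m = ⊥-elim (row≤m (atLeast-weaken (≰⇒> a≰m) row≥a))

blocked-sparseRow : (∀ {r} → r < a → Z r N) → ¬ AtLeast (row C A y) a → AtMost (A x) N →
                    Blocked Z C A x y
blocked-sparseRow {a = zero} _ row<0 _ = ⊥-elim (row<0 atLeast-zero)
blocked-sparseRow {a = suc a} {N = N} Z<a row≤a col≤N = blocked a N (Z<a ≤-refl) row≤a col≤N

RowsWithAtLeast : ℕ → Pred ℕ 0ℓ → Subset² → Pred ℕ 0ℓ
RowsWithAtLeast a C A y = AtLeast (row C A y) a

ColumnsAtMost : ℕ → Pred ℕ 0ℓ → Subset² → Set
ColumnsAtMost N C A = ∀ {x} → C x → AtMost (A x) N

grow-sucRowCount : ∀ {x₀} → C x₀ → (∀ {y} → R y → B x₀ y) →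
                   Growth.grow Z R C B ≐ Growth.grow (sucRowCount Z) R (C ∖ ｛ x₀ ｝) B
grow-sucRowCount {C} {R} {B} {Z} {x₀} cx₀ full x y = mk⇔ to from
  where
  open Growth
  without : row (C ∖ ｛ x₀ ｝) B y ⊆ row C B y ∖ ｛ x₀ ｝
  without ((c , x₀≢x) , b) = (c , b) , x₀≢x
  with′ : row C B y ∖ ｛ x₀ ｝ ⊆ row (C ∖ ｛ x₀ ｝) B y
  with′ ((c , b) , x₀≢x) = (c , x₀≢x) , b
  to : grow Z R C B x y → grow (sucRowCount Z) R (C ∖ ｛ x₀ ｝) B x y
  to (inj₁ b) = inj₁ b
  to (inj₂ (r , c , ¬b , ¬blocked)) = inj₂ (r , (c , x₀≢x) , ¬b , ¬blocked ∘ unshift)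
    where
    x₀≢x : x₀ ≢ x
    x₀≢x refl = ¬b (full r)
    unshift : Blocked (sucRowCount Z) (C ∖ ｛ x₀ ｝) B x y → Blocked Z C B x y
    unshift (blocked m n z row≤m col≤n) =
      blocked (suc m) n z (atMost-∖⇒suc x₀ (atMost-anti with′ row≤m)) col≤n
  from : grow (sucRowCount Z) R (C ∖ ｛ x₀ ｝) B x y → grow Z R C B x y
  from (inj₁ b) = inj₁ b
  from (inj₂ (r , (c , _) , ¬b , ¬blocked)) = inj₂ (r , c , ¬b , ¬blocked ∘ shift)
    where
    shift : Blocked Z C B x y → Blocked (sucRowCount Z) (C ∖ ｛ x₀ ｝) B x y
    shift (blocked zero n z row≤0 col≤n) =
      ⊥-elim (row≤0 (atLeast-insert (cx₀ , full r) atLeast-zero))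
    shift (blocked (suc m) n z row≤1+m col≤n) =
      blocked m n z (atMost-anti without (atMost-suc⇒∖ (cx₀ , full r) row≤1+m)) col≤n

grow^-sucRowCount : ∀ {x₀} → C x₀ → (∀ {y} → R y → B x₀ y) → ∀ t →
                    Growth.grow^ Z R C t B ≐ Growth.grow^ (sucRowCount Z) R (C ∖ ｛ x₀ ｝) t B
grow^-sucRowCount cx₀ full zero = ≐-refl
grow^-sucRowCount {C} {R} {B} {Z} cx₀ full (suc t) =
  ≐-trans (Growth.grow-resp Z R C (grow^-sucRowCount cx₀ full t))
          (grow-sucRowCount cx₀ (Growth.grow^-inflationary (sucRowCount Z) R _ t ∘ full))

stabilisationTime : ℕ → ℕ
stabilisationTime zero    = 1
stabilisationTime (suc s) = stabilisationTime s + suc (stabilisationTime s)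

1≤stabilisationTime : ∀ s → 1 ≤ stabilisationTime s
1≤stabilisationTime zero    = ≤-refl
1≤stabilisationTime (suc s) = ≤-trans (1≤stabilisationTime s) (m≤m+n _ _)

stabilisesBy-empty : ∀ s → (∀ {m n} → ¬ Z m n) → StabilisesBy Z (stabilisationTime s)
stabilisesBy-empty {Z} s ∅ R C A =
  Growth.stableAt-mono Z R C (1≤stabilisationTime s) (Growth.stableAt-1 Z R C ∅)

zoneOf : ZeroSet → Zone
zoneOf Zs m n = (m , n) ∈Z Zs

downClosed-zoneOf : ∀ Zs → DownClosed (zoneOf Zs)
downClosed-zoneOf (_ ∷ Zs) m′≤m n′≤n (here (m<a , n<b)) =
  here (≤-<-trans m′≤m m<a , ≤-<-trans n′≤n n<b)
downClosed-zoneOf (_ ∷ Zs) m′≤m n′≤n (there z) = there (downClosed-zoneOf Zs m′≤m n′≤n z)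

boundedBy-zoneOf : ∀ Zs → BoundedBy (sum (map proj₁ Zs)) (sum (map proj₂ Zs)) (zoneOf Zs)
boundedBy-zoneOf ((a , b) ∷ Zs) (here (m<a , n<b)) =
  <-≤-trans m<a (m≤m+n a _) , <-≤-trans n<b (m≤m+n b _)
boundedBy-zoneOf ((a , b) ∷ Zs) (there z) with boundedBy-zoneOf Zs z
... | m<A , n<B = <-≤-trans m<A (m≤n+m _ a) , <-≤-trans n<B (m≤n+m _ b)

module _ (em : ExcludedMiddle 0ℓ) where

  atMost⇒hasCount : ∀ m → AtMost P m → ∃[ k ] (k ≤ m × HasCount P k)
  atMost⇒hasCount {P} m ≤m with em {∃ P}
  ... | no ∄P = 0 , z≤n , hasCount-empty (λ x px → ∄P (x , px))
  atMost⇒hasCount zero    ≤0 | yes (z , pz) = ⊥-elim (≤0 (atLeast-insert pz atLeast-zero))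
  atMost⇒hasCount (suc m) ≤1+m | yes (z , pz) with atMost⇒hasCount m (atMost-suc⇒∖ pz ≤1+m)
  ... | k , k≤m , count = suc k , s≤s k≤m , hasCount-insert pz count

  grow-floorRowCount : DownClosed Z → (∀ {r} → r < a → Z r N) →
                       (∀ {x y} → A x y → B x y) →
                       (∀ {x y} → ¬ RowsWithAtLeast a C A y → B x y → A x y) →
                       ColumnsAtMost N C B →
                       Growth.grow Z R C B ≐
                       Growth.grow (floorRowCount a Z) (R ∩ RowsWithAtLeast a C A) C B
  grow-floorRowCount {Z} {a} {N} {A} {B} {C} {R} dc Z<a A⊆B sparseFixed col≤N x y = mk⇔ to from
    where
    open Growth
    Rich : Pred ℕ 0ℓ
    Rich = RowsWithAtLeast a C A
    to : grow Z R C B x y → grow (floorRowCount a Z) (R ∩ Rich) C B x y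
    to (inj₁ b) = inj₁ b
    to (inj₂ (r , c , ¬b , ¬blocked)) with em {Rich y}
    ... | yes rich = inj₂ ((r , rich) , c , ¬b , ¬blocked ∘ blocked-floorRowCount⇒blocked dc)
    ... | no sparse =
      ⊥-elim (¬blocked (blocked-sparseRow Z<a (sparse ∘ atLeast-mono unchanged) (col≤N c)))
      where
      unchanged : row C B y ⊆ row C A y
      unchanged (c , b) = c , sparseFixed sparse b
    from : grow (floorRowCount a Z) (R ∩ Rich) C B x y → grow Z R C B x y
    from (inj₁ b) = inj₁ b
    from (inj₂ ((r , rich) , c , ¬b , ¬blocked)) =
      inj₂ (r , c , ¬b , ¬blocked ∘ blocked⇒blocked-floorRowCount richInB)
      where
      richInB : AtLeast (row C B y) a
      richInB = atLeast-mono (λ (c , a) → c , A⊆B a) rich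

  grow^-floorRowCount : DownClosed Z → (∀ {r} → r < a → Z r N) → ∀ t →
                        (∀ {t′} → t′ < t → ColumnsAtMost N C (Growth.grow^ Z R C t′ A)) →
                        Growth.grow^ Z R C t A ≐
                        Growth.grow^ (floorRowCount a Z) (R ∩ RowsWithAtLeast a C A) C t A
  grow^-floorRowCount dc Z<a zero _ = ≐-refl
  grow^-floorRowCount {Z} {a} {N} {C} {R} {A} dc Z<a (suc t) col≤N =
    ≐-trans (G.grow-resp IH)
            (grow-floorRowCount dc Z<a (G*.grow^-inflationary t)
                                (λ sparse → G*.grow^-fixesRow t (sparse ∘ proj₂))
                                (atMost-anti (≐⇒⊆ (≐-sym IH)) ∘ col≤N ≤-refl))
    where
    module G = Growth Z R C
    module G* = Growth (floorRowCount a Z) (R ∩ RowsWithAtLeast a C A) C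
    IH : G.grow^ t A ≐ G*.grow^ t A
    IH = grow^-floorRowCount dc Z<a t (col≤N ∘ m<n⇒m<1+n)

  stableAt-unsaturated : ∀ {T} → DownClosed Z → (∀ {r} → r < a → Z r N) →
                         StabilisesBy (floorRowCount a Z) T →
                         (∀ {t} → t ≤ T → ColumnsAtMost N C (Growth.grow^ Z R C t A)) →
                         Growth.StableAt Z R C A T
  stableAt-unsaturated {a = a} {C = C} {R} {A} {T} dc Z<a stable col≤N =
    ≐-trans (grow^-floorRowCount dc Z<a (suc T) (col≤N ∘ ≤-pred))
            (≐-trans (stable (R ∩ RowsWithAtLeast a C A) C A)
                     (≐-sym (grow^-floorRowCount dc Z<a T (col≤N ∘ <⇒≤))))

  stableAt-saturated : ∀ {T t x₀} → BoundedBy M (suc N) Z → StabilisesBy (sucRowCount Z) T →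
                       C x₀ → AtLeast (Growth.grow^ Z R C t A x₀) (suc N) →
                       Growth.StableAt Z R C A (T + suc t)
  stableAt-saturated {N = N} {Z} {C} {R} {A} {T} {t} {x₀} bounded stable cx₀ saturated =
    subst (λ S → G.grow S ≐ S) (sym (G.grow^-+ T (suc t) A))
      (≐-trans (grow^-sucRowCount cx₀ full (suc T))
               (≐-trans (stable R (C ∖ ｛ x₀ ｝) A₁) (≐-sym (grow^-sucRowCount cx₀ full T))))
    where
    module G = Growth Z R C
    A₁ : Subset²
    A₁ = G.grow^ (suc t) A
    -- a column with more than N points has no blocked point
    full : ∀ {y} → R y → A₁ x₀ y
    full {y} r with em {G.grow^ t A x₀ y}
    ... | yes a = inj₁ a
    ... | no ¬a = inj₂ (r , cx₀ , ¬a , λ (blocked _ n z _ col≤n) →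
                          col≤n (atLeast-weaken (proj₂ (bounded z)) saturated))

  stabilisesBy-step : ∀ {T} → DownClosed Z → BoundedBy M (suc N) Z → (∀ {r} → r < a → Z r N) →
                      StabilisesBy (floorRowCount a Z) T → StabilisesBy (sucRowCount Z) T →
                      StabilisesBy Z (T + suc T)
  stabilisesBy-step {Z} {N = N} {T = T} dc bounded Z<a stable* stable″ R C A = by-cases em
    where
    module G = Growth Z R C
    Saturated : Set
    Saturated = ∃[ t ] (t ≤ T × ∃[ x ] (C x × AtLeast (G.grow^ t A x) (suc N)))
    by-cases : Dec Saturated → G.StableAt A (T + suc T)
    by-cases (no unsaturated) =
      G.stableAt-mono (m≤m+n T (suc T))
        (stableAt-unsaturated dc Z<a stable* λ t≤T c saturated →
                                             unsaturated (_ , t≤T , _ , c , saturated))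
    by-cases (yes (t , t≤T , x₀ , c , saturated)) =
      G.stableAt-mono (+-monoʳ-≤ T (s≤s t≤T))
        (stableAt-saturated {T = T} {t} bounded stable″ c saturated)

  stabilisesBy-bounded : ∀ s {M N Z} → M + N ≤ s → DownClosed Z → BoundedBy M N Z →
                         StabilisesBy Z (stabilisationTime s)
  stabilisesBy-bounded s {zero} _ _ bounded =
    stabilisesBy-empty s λ z → n≮0 (proj₁ (bounded z))
  stabilisesBy-bounded s {suc M} {zero} _ _ bounded =
    stabilisesBy-empty s λ z → n≮0 (proj₂ (bounded z))
  stabilisesBy-bounded zero {suc M} {suc N} () _ _
  stabilisesBy-bounded (suc s) {suc M} {suc N} {Z} M+N≤s dc bounded
    with least-counterexample (λ _ → em) (λ z → n≮n (suc M) (proj₁ (bounded {n = N} z)))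
  ... | a , Z<a , ¬Za =
    stabilisesBy-step {T = stabilisationTime s} dc bounded Z<a
      (stabilisesBy-bounded s (≤-pred (subst (_≤ suc s) (+-suc (suc M) N) M+N≤s))
                            (downClosed-floorRowCount dc) (boundedBy-floorRowCount dc bounded ¬Za))
      (stabilisesBy-bounded s (≤-pred M+N≤s)
                            (downClosed-sucRowCount dc) (boundedBy-sucRowCount bounded))

  countsInZ⇔blocked : ∀ Zs {i j} → CountsInZ Zs A i j ⇔ Blocked (zoneOf Zs) U A i j
  countsInZ⇔blocked {A} Zs {i} {j} = mk⇔ to from
    where
    to : CountsInZ Zs A i j → Blocked (zoneOf Zs) U A i j
    to (m , n , row=m , col=n , z) =
      blocked m n z (hasCount⇒atMost row=m ∘ atLeast-mono proj₂) (hasCount⇒atMost col=n)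
    from : Blocked (zoneOf Zs) U A i j → CountsInZ Zs A i j
    from (blocked m n z row≤m col≤n)
      with atMost⇒hasCount m (atMost-anti (tt ,_) row≤m) | atMost⇒hasCount n col≤n
    ... | k , k≤m , row=k | l , l≤n , col=l = k , l , row=k , col=l , downClosed-zoneOf Zs k≤m l≤n z

  𝒯≐grow : ∀ Zs A → 𝒯 Zs A ≐ Growth.grow (zoneOf Zs) U U A
  𝒯≐grow Zs A i j = mk⇔ to from
    where
    to : 𝒯 Zs A i j → Growth.grow (zoneOf Zs) U U A i j
    to (inj₁ a) = inj₁ a
    to (inj₂ (¬a , ¬counts)) =
      inj₂ (tt , tt , ¬a , ¬counts ∘ Equivalence.from (countsInZ⇔blocked Zs))
    from : Growth.grow (zoneOf Zs) U U A i j → 𝒯 Zs A i j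
    from (inj₁ a) = inj₁ a
    from (inj₂ (_ , _ , ¬a , ¬blocked)) =
      inj₂ (¬a , ¬blocked ∘ Equivalence.to (countsInZ⇔blocked Zs))

  𝒯^≐grow^ : ∀ Zs t A → 𝒯^ Zs t A ≐ Growth.grow^ (zoneOf Zs) U U t A
  𝒯^≐grow^ Zs zero    A = ≐-refl
  𝒯^≐grow^ Zs (suc t) A =
    ≐-trans (𝒯≐grow Zs _) (Growth.grow-resp (zoneOf Zs) U U (𝒯^≐grow^ Zs t A))

theorem2p8 : ExcludedMiddle 0ℓ → (Z : ZeroSet) →
    ∃[ Tmax ] ((A : Subset²) → 𝒯^ Z (suc Tmax) A ≐ 𝒯^ Z Tmax A)
theorem2p8 em Zs = stabilisationTime s , λ A →
  ≐-trans (𝒯^≐grow^ em Zs (suc (stabilisationTime s)) A)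
    (≐-trans (stabilisesBy-bounded em s ≤-refl (downClosed-zoneOf Zs) (boundedBy-zoneOf Zs) U U A)
             (≐-sym (𝒯^≐grow^ em Zs (stabilisationTime s) A)))
  where
  s : ℕ
  s = sum (map proj₁ Zs) + sum (map proj₂ Zs)
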